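{- Let $(M,\exists)$ be a monadic algebra and $\Upsilon$ a ubiquity operator on it. Then for all $p\in M$, $\Upsilon p\wedge\Upsilon p'=0$.
   Context: A monadic algebra is a Boolean algebra $M$ (operations $\wedge,\vee,{}'$, constants $0,1$, order $\le$) together with a map $\exists:M\to M$ such that $\exists 0=0$, $p\le\exists p$, and $\exists(p\wedge\exists q)=\exists p\wedge\exists q$ for all $p,q$. Write $\forall p:=(\exists p')'$. A ubiquity operator on $M$ is a map $\Upsilon:M\to M$ such that for all $p,q\in M$: (i) $\Upsilon p\wedge\Upsilon q\le\Upsilon(p\wedge q)$; (ii) $\Upsilon p\le\Upsilon(p\vee q)$; (iii) $\forall p\le\Upsilon p\le\exists p$. -}

module Defs where

open import Level using (Level; _⊔_; suc)
open import Algebra.Lattice.Bundles using (BooleanAlgebra)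

record MonadicAlgebra (c ℓ : Level) : Set (suc (c ⊔ ℓ)) where
  field
    boolAlg : BooleanAlgebra c ℓ
  open BooleanAlgebra boolAlg public
  _≤_ : Carrier → Carrier → Set ℓ
  p ≤ q = (p ∧ q) ≈ p
  field
    ∃       : Carrier → Carrier
    ∃-cong  : ∀ {p q} → p ≈ q → ∃ p ≈ ∃ q
    ∃-zero  : ∃ ⊥ ≈ ⊥
    ∃-incr  : ∀ p → p ≤ ∃ p
    ∃-quasi : ∀ p q → ∃ (p ∧ ∃ q) ≈ (∃ p ∧ ∃ q)
  ∀′ : Carrier → Carrier
  ∀′ p = ¬ (∃ (¬ p))

record IsUbiquity {c ℓ} (M : MonadicAlgebra c ℓ)
                  (Υ : MonadicAlgebra.Carrier M → MonadicAlgebra.Carrier M)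
                  : Set (c ⊔ ℓ) where
  open MonadicAlgebra M
  field
    Υ-cong : ∀ {p q} → p ≈ q → Υ p ≈ Υ q
    Υ-∧    : ∀ p q → (Υ p ∧ Υ q) ≤ Υ (p ∧ q)
    Υ-∨    : ∀ p q → Υ p ≤ Υ (p ∨ q)
    Υ-lower : ∀ p → ∀′ p ≤ Υ p
    Υ-upper : ∀ p → Υ p ≤ ∃ p

module Submission where

open import Defs
import Algebra.Lattice.Properties.BooleanAlgebra as BooleanAlgebraProperties
import Relation.Binary.Reasoning.Setoid as SetoidReasoning

-- Υ 0 ≤ ∃ 0 = 0, and Υ is meet-closed, so Υ p ∧ Υ p′ lies below Υ (p ∧ p′) = Υ 0 = 0.

module UbiquityProperties {c ℓ} (M : MonadicAlgebra c ℓ)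
                          {Υ : MonadicAlgebra.Carrier M → MonadicAlgebra.Carrier M}
                          (isUbiquity : IsUbiquity M Υ) where

  open MonadicAlgebra M
  open IsUbiquity isUbiquity
  open BooleanAlgebraProperties boolAlg using (∧-zeroʳ)
  open SetoidReasoning setoid

  ≤⊥⇒≈⊥ : ∀ {p} → p ≤ ⊥ → p ≈ ⊥
  ≤⊥⇒≈⊥ {p} p≤⊥ = trans (sym p≤⊥) (∧-zeroʳ p)

  Υ-⊥ : Υ ⊥ ≈ ⊥
  Υ-⊥ = ≤⊥⇒≈⊥ (begin
    Υ ⊥ ∧ ⊥   ≈⟨ ∧-congˡ ∃-zero ⟨
    Υ ⊥ ∧ ∃ ⊥ ≈⟨ Υ-upper ⊥ ⟩
    Υ ⊥       ∎)

  Υ-complement-disjoint : ∀ p → Υ p ∧ Υ (¬ p) ≈ ⊥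
  Υ-complement-disjoint p = ≤⊥⇒≈⊥ (begin
    a ∧ ⊥             ≈⟨ ∧-congˡ Υ-⊥ ⟨
    a ∧ Υ ⊥           ≈⟨ ∧-congˡ (Υ-cong (∧-complementʳ p)) ⟨
    a ∧ Υ (p ∧ ¬ p)   ≈⟨ Υ-∧ p (¬ p) ⟩
    a                 ∎)
    where
    a : Carrier
    a = Υ p ∧ Υ (¬ p)

mainTheorem6 : ∀ {c ℓ} (M : MonadicAlgebra c ℓ)
    (Υ : MonadicAlgebra.Carrier M → MonadicAlgebra.Carrier M) →
    IsUbiquity M Υ →
    ∀ p → MonadicAlgebra._≈_ M (MonadicAlgebra._∧_ M (Υ p) (Υ (MonadicAlgebra.¬_ M p))) (MonadicAlgebra.⊥ M)
mainTheorem6 M Υ isUbiquity = UbiquityProperties.Υ-complement-disjoint M isUbiquity
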